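{- Let $\iota$ be an involution avoiding the pattern $123$. Then $\mathrm{coinv}(\iota)$ is odd if and only if the length of $\iota$ is even and $\iota$ has a fixed point.
   Context: A permutation $\sigma$ of $[n]$ (one-line notation) contains a pattern $\pi\in\mathfrak{S}_k$ if some subsequence $\sigma(m_1)\cdots\sigma(m_k)$ with $m_1<\dots<m_k$ is in the same relative order as $\pi$; otherwise it avoids $\pi$. An involution is a permutation with $\iota^2=\mathrm{id}$; a fixed point is $i$ with $\iota(i)=i$. $\mathrm{coinv}(\sigma)$ is the number of pairs $i<j$ with $\sigma(i)<\sigma(j)$. -}

module Defs where

open import Data.Nat using (ℕ; _+_)
open import Data.Fin using (Fin; _<_)
open import Data.Fin.Properties using (_<?_)
open import Data.Fin.Permutation using (Permutation′; _⟨$⟩ʳ_)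
open import Data.List using (List; length; filter; allFin; concatMap; map)
open import Data.Product using (_×_; _,_; ∃-syntax; proj₁; proj₂)
open import Relation.Binary.PropositionalEquality using (_≡_)
open import Relation.Nullary using (¬_)
open import Relation.Nullary.Decidable using (_×-dec_)

IsInvolution : ∀ {n} → Permutation′ n → Set
IsInvolution {n} ι = ∀ (i : Fin n) → ι ⟨$⟩ʳ (ι ⟨$⟩ʳ i) ≡ i

HasFixedPoint : ∀ {n} → Permutation′ n → Set
HasFixedPoint {n} σ = ∃[ i ] σ ⟨$⟩ʳ i ≡ i

Contains123 : ∀ {n} → Permutation′ n → Set
Contains123 {n} σ = ∃[ i ] ∃[ j ] ∃[ k ]
  (i < j × j < k × σ ⟨$⟩ʳ i < σ ⟨$⟩ʳ j × σ ⟨$⟩ʳ j < σ ⟨$⟩ʳ k)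

Avoids123 : ∀ {n} → Permutation′ n → Set
Avoids123 σ = ¬ Contains123 σ

allPairs : ∀ n → List (Fin n × Fin n)
allPairs n = concatMap (λ i → map (i ,_) (allFin n)) (allFin n)

coinv : ∀ {n} → Permutation′ n → ℕ
coinv {n} σ = length (filter
  (λ p → (proj₁ p <? proj₂ p) ×-dec (σ ⟨$⟩ʳ proj₁ p <? σ ⟨$⟩ʳ proj₂ p))
  (allPairs n))

module Submission where

-- An involution τ of [m] permutes the points of [m]; a point
-- is fixed, moved up (i < τ i) or moved down (τ i < i), and τ exchanges the
-- moved-up with the moved-down points.  Hence for every τ-invariant weight f,
--   Σ f ≡ Σ_{i fixed} f i   (mod 2).
-- Applied to the constant weight 1 this gives n ≡ F (mod 2), F the number of
-- fixed points of ι.  Applied twice to the coinversion indicator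
-- q(i,j) = [i < j ∧ ι i < ι j], which is invariant under (i,j) ↦ (ι i,ι j),
-- it gives coinv ι ≡ #{i < j both fixed} = A (mod 2), and A satisfies the
-- counting identity F + 2A = F².  Finally the fixed points of ι form an
-- increasing subsequence of values, so 123-avoidance forces F ≤ 2; checking
-- F = 0, 1, 2 in F + 2A = F² yields  A odd ⇔ (F even ∧ F ≥ 1).

open import Defs
open import Data.Nat using (ℕ; _%_)
open import Data.Fin.Permutation using (Permutation′)
open import Data.Product using (_×_)
open import Function.Bundles using (_⇔_)
open import Relation.Binary.PropositionalEquality using (_≡_)

open import Data.Nat using (zero; suc; _+_; _*_; _≤_; z≤n; s≤s)
import Data.Nat.Properties as ℕ
open import Data.Nat.DivMod using (%-distribˡ-+; [m+kn]%n≡m%n)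
open import Data.Nat.Tactic.RingSolver using (solve-∀)
open import Data.Fin using (Fin; zero; suc; _<_)
open import Data.Fin.Properties using (_<?_; _≟_; <-cmp; <-irrefl; <-asym)
open import Data.Fin.Permutation using (_⟨$⟩ʳ_; permutation)
open import Data.List using (List; []; _∷_; _++_; length; filter; allFin; concat; map; tabulate)
open import Data.List.Properties using (length-++; filter-++; map-tabulate)
open import Data.List.Membership.Propositional using (_∈_)
open import Data.List.Membership.Propositional.Properties using (∈-filter⁺; ∈-allFin)
open import Data.List.Relation.Unary.All using (All; []; _∷_)
open import Data.List.Relation.Unary.All.Properties using (all-filter)
open import Data.List.Relation.Unary.Any using (here; there)
open import Data.List.Relation.Unary.AllPairs using (AllPairs; []; _∷_)
import Data.List.Relation.Unary.AllPairs.Properties as AllPairs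
open import Data.Product using (_,_; proj₁; proj₂)
open import Data.Product.Function.NonDependent.Propositional using (_×-⇔_)
open import Data.Bool using (true; false; if_then_else_)
open import Data.Empty using (⊥-elim)
open import Function using (id)
open import Function.Bundles using (mk⇔)
import Function.Properties.Equivalence as ⇔
open import Relation.Nullary using (Dec; yes; no; does; ¬_)
open import Relation.Nullary.Decidable using (_×-dec_)
open import Relation.Unary using (Pred; Decidable)
open import Relation.Binary using (tri<; tri≈; tri>)
open import Relation.Binary.PropositionalEquality
  using (refl; sym; trans; cong; cong₂; subst; subst₂; module ≡-Reasoning)
open import Algebra.Properties.Semiring.Sum ℕ.+-*-semiring
  using (sum; sum-cong-≗; sum-permute; *-distribˡ-sum)

⟦_⟧ : ∀ {p} {P : Set p} → Dec P → ℕ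
⟦ d ⟧ = if does d then 1 else 0

⟦⟧-yes : ∀ {p} {P : Set p} → P → (d : Dec P) → ⟦ d ⟧ ≡ 1
⟦⟧-yes x (yes _) = refl
⟦⟧-yes x (no ¬x) = ⊥-elim (¬x x)

⟦⟧-no : ∀ {p} {P : Set p} → ¬ P → (d : Dec P) → ⟦ d ⟧ ≡ 0
⟦⟧-no ¬x (yes x) = ⊥-elim (¬x x)
⟦⟧-no ¬x (no _) = refl

⟦⟧-⇔ : ∀ {p q} {P : Set p} {Q : Set q} → (P → Q) → (Q → P) →
  (d : Dec P) (e : Dec Q) → ⟦ d ⟧ ≡ ⟦ e ⟧
⟦⟧-⇔ f g (yes x) e = sym (⟦⟧-yes (f x) e)
⟦⟧-⇔ f g (no ¬x) e = sym (⟦⟧-no (λ y → ¬x (g y)) e)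

module Counting {a p} {A : Set a} {P : Pred A p} (P? : Decidable P) where

  count-∷ : ∀ x xs → length (filter P? (x ∷ xs)) ≡ ⟦ P? x ⟧ + length (filter P? xs)
  count-∷ x xs with does (P? x)
  ... | true  = refl
  ... | false = refl

  count-++ : ∀ xs ys → length (filter P? (xs ++ ys)) ≡ length (filter P? xs) + length (filter P? ys)
  count-++ xs ys = trans (cong length (filter-++ P? xs ys)) (length-++ (filter P? xs))

  count-tabulate : ∀ {n} (f : Fin n → A) → length (filter P? (tabulate f)) ≡ sum (λ i → ⟦ P? (f i) ⟧)
  count-tabulate {zero}  f = refl
  count-tabulate {suc n} f =
    trans (count-∷ (f zero) (tabulate (λ i → f (suc i))))
          (cong (⟦ P? (f zero) ⟧ +_) (count-tabulate (λ i → f (suc i))))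

  count-concat-tabulate : ∀ {n} (xss : Fin n → List A) →
    length (filter P? (concat (tabulate xss))) ≡ sum (λ i → length (filter P? (xss i)))
  count-concat-tabulate {zero}  xss = refl
  count-concat-tabulate {suc n} xss =
    trans (count-++ (xss zero) (concat (tabulate (λ i → xss (suc i)))))
          (cong (length (filter P? (xss zero)) +_) (count-concat-tabulate (λ i → xss (suc i))))

open Counting

sum-+ : ∀ {n} (f g : Fin n → ℕ) → sum (λ i → f i + g i) ≡ sum f + sum g
sum-+ {zero}  f g = refl
sum-+ {suc n} f g =
  trans (cong (f zero + g zero +_) (sum-+ (λ i → f (suc i)) (λ i → g (suc i))))
        (interchange (f zero) (g zero) _ _)
  where
  interchange : ∀ a b c d → a + b + (c + d) ≡ a + c + (b + d)
  interchange = solve-∀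

sum-ones : ∀ n → sum {n} (λ _ → 1) ≡ n
sum-ones zero    = refl
sum-ones (suc n) = cong suc (sum-ones n)

sum-cong-%2 : ∀ {n} (f g : Fin n → ℕ) → (∀ i → f i % 2 ≡ g i % 2) → sum f % 2 ≡ sum g % 2
sum-cong-%2 {zero}  f g f≡g = refl
sum-cong-%2 {suc n} f g f≡g = begin
  (f zero + sum (λ i → f (suc i))) % 2
    ≡⟨ %-distribˡ-+ (f zero) _ 2 ⟩
  (f zero % 2 + sum (λ i → f (suc i)) % 2) % 2
    ≡⟨ cong₂ (λ x y → (x + y) % 2) (f≡g zero) (sum-cong-%2 _ _ (λ i → f≡g (suc i))) ⟩
  (g zero % 2 + sum (λ i → g (suc i)) % 2) % 2
    ≡⟨ sym (%-distribˡ-+ (g zero) _ 2) ⟩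
  (g zero + sum (λ i → g (suc i))) % 2 ∎
  where open ≡-Reasoning

-- The parity lemma for involutions: if τ ∘ τ = id and the weight f is
-- τ-invariant, the moved-down points contribute exactly what the moved-up
-- points contribute, so only fixed points matter modulo 2.
module Involution {n} (τ : Fin n → Fin n) (τ-invol : ∀ i → τ (τ i) ≡ i) where

  fixed movedUp movedDown : Fin n → ℕ
  fixed     i = ⟦ τ i ≟ i ⟧
  movedUp   i = ⟦ i <? τ i ⟧
  movedDown i = ⟦ τ i <? i ⟧

  sum-reindex : (f : Fin n → ℕ) → sum f ≡ sum (λ i → f (τ i))
  sum-reindex f = sum-permute f (permutation τ τ τ-invol τ-invol)

  trichotomy : ∀ i → fixed i + movedUp i + movedDown i ≡ 1
  trichotomy i with <-cmp i (τ i)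
  ... | tri< i<τi _ _
    rewrite ⟦⟧-no (λ e → <-irrefl (sym e) i<τi) (τ i ≟ i)
          | ⟦⟧-yes i<τi (i <? τ i)
          | ⟦⟧-no (<-asym i<τi) (τ i <? i) = refl
  ... | tri≈ _ i≡τi _
    rewrite ⟦⟧-yes (sym i≡τi) (τ i ≟ i)
          | ⟦⟧-no (<-irrefl i≡τi) (i <? τ i)
          | ⟦⟧-no (<-irrefl (sym i≡τi)) (τ i <? i) = refl
  ... | tri> _ _ τi<i
    rewrite ⟦⟧-no (λ e → <-irrefl e τi<i) (τ i ≟ i)
          | ⟦⟧-no (<-asym τi<i) (i <? τ i)
          | ⟦⟧-yes τi<i (τ i <? i) = refl

  module _ (f : Fin n → ℕ) (f-inv : ∀ i → f (τ i) ≡ f i) where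

    -- τ maps the moved-up points bijectively onto the moved-down points.
    sum-movedDown : sum (λ i → movedDown i * f i) ≡ sum (λ i → movedUp i * f i)
    sum-movedDown = trans (sum-reindex _)
      (sum-cong-≗ (λ i → cong₂ _*_ (cong (λ x → ⟦ x <? τ i ⟧) (τ-invol i)) (f-inv i)))

    involution-sum : sum f ≡ sum (λ i → fixed i * f i) + sum (λ i → movedUp i * f i) * 2
    involution-sum = begin
      sum f
        ≡⟨ sum-cong-≗ split ⟩
      sum (λ i → fixed i * f i + movedUp i * f i + movedDown i * f i)
        ≡⟨ sum-+ (λ i → fixed i * f i + movedUp i * f i) _ ⟩
      sum (λ i → fixed i * f i + movedUp i * f i) + sum (λ i → movedDown i * f i)
        ≡⟨ cong₂ _+_ (sum-+ (λ i → fixed i * f i) _) sum-movedDown ⟩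
      sum (λ i → fixed i * f i) + sum (λ i → movedUp i * f i) + sum (λ i → movedUp i * f i)
        ≡⟨ double (sum (λ i → fixed i * f i)) (sum (λ i → movedUp i * f i)) ⟩
      sum (λ i → fixed i * f i) + sum (λ i → movedUp i * f i) * 2 ∎
      where
      open ≡-Reasoning
      distrib : ∀ a b c x → (a + b + c) * x ≡ a * x + b * x + c * x
      distrib = solve-∀
      double : ∀ x y → x + y + y ≡ x + y * 2
      double = solve-∀
      split : ∀ i → f i ≡ fixed i * f i + movedUp i * f i + movedDown i * f i
      split i = trans (sym (ℕ.*-identityˡ (f i)))
        (trans (cong (_* f i) (sym (trichotomy i))) (distrib (fixed i) _ _ (f i)))

    involution-parity : sum f % 2 ≡ sum (λ i → fixed i * f i) % 2
    involution-parity = trans (cong (_% 2) involution-sum) ([m+kn]%n≡m%n (sum (λ i → fixed i * f i)) (sum (λ i → movedUp i * f i)) 2)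

pairs : ∀ {m} → (Fin m → ℕ) → ℕ
pairs g = sum (λ i → sum (λ j → ⟦ i <? j ⟧ * g i * g j))

pairs-step : ∀ {m} (g : Fin (suc m) → ℕ) →
  pairs g ≡ g zero * sum (λ j → g (suc j)) + pairs (λ j → g (suc j))
pairs-step g = cong (_+ pairs (λ j → g (suc j)))
  (trans (sum-cong-≗ (λ j → cong (_* g (suc j)) (ℕ.+-identityʳ (g zero))))
         (sym (*-distribˡ-sum (g zero) (λ j → g (suc j)))))

-- For a 0/1 weight with F = Σ g ones, the pairs of ones number F(F-1)/2:
-- F + 2·pairs = F².
pairs-formula : ∀ {m p} {P : Pred (Fin m) p} (P? : Decidable P) →
  sum (λ i → ⟦ P? i ⟧) + pairs (λ i → ⟦ P? i ⟧) * 2 ≡ sum (λ i → ⟦ P? i ⟧) * sum (λ i → ⟦ P? i ⟧)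
pairs-formula {zero} P? = refl
pairs-formula {suc m} P? rewrite pairs-step (λ i → ⟦ P? i ⟧)
  with pairs-formula (λ i → P? (suc i)) | P? zero
... | ih | no _  = ih
... | ih | yes _ = begin
  1 + F + (1 * F + A) * 2  ≡⟨ expand F A ⟩
  1 + F * 2 + (F + A * 2)  ≡⟨ cong (1 + F * 2 +_) ih ⟩
  1 + F * 2 + F * F        ≡⟨ square F ⟩
  (1 + F) * (1 + F)        ∎
  where
  open ≡-Reasoning
  F = sum (λ i → ⟦ P? (suc i) ⟧)
  A = pairs (λ i → ⟦ P? (suc i) ⟧)
  expand : ∀ F A → 1 + F + (1 * F + A) * 2 ≡ 1 + F * 2 + (F + A * 2)
  expand = solve-∀
  square : ∀ F → 1 + F * 2 + F * F ≡ (1 + F) * (1 + F)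
  square = solve-∀

-- When F ≤ 2, the identity F + 2A = F² pins A down: A is odd exactly when
-- F = 2, i.e. when F is even and positive.
pairs-parity : ∀ {F A} → F ≤ 2 → F + A * 2 ≡ F * F → (A % 2 ≡ 1) ⇔ ((F % 2 ≡ 0) × 1 ≤ F)
pairs-parity {0} {0}             _ _  = mk⇔ (λ ()) (λ { (_ , ()) })
pairs-parity {1} {0}             _ _  = mk⇔ (λ ()) (λ { (() , _) })
pairs-parity {2} {1}             _ _  = mk⇔ (λ _ → refl , s≤s z≤n) (λ _ → refl)
pairs-parity {0} {suc A}         _ ()
pairs-parity {1} {suc A}         _ ()
pairs-parity {2} {0}             _ ()
pairs-parity {2} {suc (suc A)}   _ ()
pairs-parity {suc (suc (suc F))} (s≤s (s≤s ())) _

module Coinversions {n} (ι : Permutation′ n) (ι-invol : IsInvolution ι) where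

  open Involution (ι ⟨$⟩ʳ_) ι-invol using (fixed; sum-reindex; involution-parity)

  Coinversion? : ∀ i j → Dec (i < j × ι ⟨$⟩ʳ i < ι ⟨$⟩ʳ j)
  Coinversion? i j = (i <? j) ×-dec (ι ⟨$⟩ʳ i <? ι ⟨$⟩ʳ j)

  coinvPair : Fin n → Fin n → ℕ
  coinvPair i j = ⟦ Coinversion? i j ⟧

  row : Fin n → ℕ
  row i = sum (coinvPair i)

  coinv-as-sum : coinv ι ≡ sum row
  coinv-as-sum = begin
    coinv ι
      ≡⟨ cong (λ pss → length (filter P? (concat pss))) (map-tabulate id pairsWith) ⟩
    length (filter P? (concat (tabulate pairsWith)))
      ≡⟨ count-concat-tabulate P? pairsWith ⟩
    sum (λ i → length (filter P? (pairsWith i)))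
      ≡⟨ sum-cong-≗ (λ i → trans (cong (λ ps → length (filter P? ps)) (map-tabulate id (i ,_)))
                                 (count-tabulate P? (i ,_))) ⟩
    sum row ∎
    where
    open ≡-Reasoning
    P? : (p : Fin n × Fin n) → Dec (proj₁ p < proj₂ p × ι ⟨$⟩ʳ proj₁ p < ι ⟨$⟩ʳ proj₂ p)
    P? p = Coinversion? (proj₁ p) (proj₂ p)
    pairsWith : Fin n → List (Fin n × Fin n)
    pairsWith i = map (i ,_) (allFin n)

  coinvPair-invariant : ∀ i j → coinvPair (ι ⟨$⟩ʳ i) (ι ⟨$⟩ʳ j) ≡ coinvPair i j
  coinvPair-invariant i j = ⟦⟧-⇔ forth back (Coinversion? (ι ⟨$⟩ʳ i) (ι ⟨$⟩ʳ j)) (Coinversion? i j)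
    where
    forth : _ < _ × _ < _ → i < j × ι ⟨$⟩ʳ i < ι ⟨$⟩ʳ j
    forth (ιi<ιj , ιιi<ιιj) = subst₂ _<_ (ι-invol i) (ι-invol j) ιιi<ιιj , ιi<ιj
    back : i < j × ι ⟨$⟩ʳ i < ι ⟨$⟩ʳ j → _ < _ × _ < _
    back (i<j , ιi<ιj) = ιi<ιj , subst₂ _<_ (sym (ι-invol i)) (sym (ι-invol j)) i<j

  row-invariant : ∀ i → row (ι ⟨$⟩ʳ i) ≡ row i
  row-invariant i = trans (sum-reindex (coinvPair (ι ⟨$⟩ʳ i))) (sum-cong-≗ (coinvPair-invariant i))

  -- For a fixed row index i, the row j ↦ coinvPair i j is ι-invariant;
  -- multiplying by fixed i makes this hold for every i.
  fixed-row-invariant : ∀ i j → fixed i * coinvPair i (ι ⟨$⟩ʳ j) ≡ fixed i * coinvPair i j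
  fixed-row-invariant i j with ι ⟨$⟩ʳ i ≟ i
  ... | no _    = refl
  ... | yes ιi≡i = cong (1 *_)
    (trans (cong (λ k → coinvPair k (ι ⟨$⟩ʳ j)) (sym ιi≡i)) (coinvPair-invariant i j))

  -- Between fixed points, a coinversion is just an increasing pair of positions.
  fixed-pair : ∀ i j → fixed j * (fixed i * coinvPair i j) ≡ ⟦ i <? j ⟧ * fixed i * fixed j
  fixed-pair i j with ι ⟨$⟩ʳ i ≟ i | ι ⟨$⟩ʳ j ≟ j
  ... | no _ | ιj≟j = trans (ℕ.*-zeroʳ ⟦ ιj≟j ⟧) (cong (_* ⟦ ιj≟j ⟧) (sym (ℕ.*-zeroʳ ⟦ i <? j ⟧)))
  ... | yes _ | no _ = sym (ℕ.*-zeroʳ (⟦ i <? j ⟧ * 1))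
  ... | yes ιi≡i | yes ιj≡j = begin
    1 * (1 * coinvPair i j) ≡⟨ trans (ℕ.*-identityˡ _) (ℕ.*-identityˡ _) ⟩
    coinvPair i j           ≡⟨ ⟦⟧-⇔ proj₁ (λ i<j → i<j , subst₂ _<_ (sym ιi≡i) (sym ιj≡j) i<j)
                                    (Coinversion? i j) (i <? j) ⟩
    ⟦ i <? j ⟧              ≡⟨ sym (trans (ℕ.*-identityʳ _) (ℕ.*-identityʳ _)) ⟩
    ⟦ i <? j ⟧ * 1 * 1      ∎
    where open ≡-Reasoning

  -- Two applications of the involution parity lemma: first to the rows,
  -- then to the entries of each fixed row.
  coinv-parity : coinv ι % 2 ≡ pairs fixed % 2
  coinv-parity = begin
    coinv ι % 2
      ≡⟨ cong (_% 2) coinv-as-sum ⟩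
    sum row % 2
      ≡⟨ involution-parity row row-invariant ⟩
    sum (λ i → fixed i * row i) % 2
      ≡⟨ cong (_% 2) (sum-cong-≗ (λ i → *-distribˡ-sum (fixed i) (coinvPair i))) ⟩
    sum (λ i → sum (λ j → fixed i * coinvPair i j)) % 2
      ≡⟨ sum-cong-%2 _ _ (λ i → involution-parity (λ j → fixed i * coinvPair i j) (fixed-row-invariant i)) ⟩
    sum (λ i → sum (λ j → fixed j * (fixed i * coinvPair i j))) % 2
      ≡⟨ cong (_% 2) (sum-cong-≗ (λ i → sum-cong-≗ (fixed-pair i))) ⟩
    pairs fixed % 2 ∎
    where open ≡-Reasoning

  length-parity : n % 2 ≡ sum fixed % 2
  length-parity = begin
    n % 2                           ≡⟨ cong (_% 2) (sym (sum-ones n)) ⟩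
    sum {n} (λ _ → 1) % 2           ≡⟨ involution-parity (λ _ → 1) (λ _ → refl) ⟩
    sum (λ i → fixed i * 1) % 2     ≡⟨ cong (_% 2) (sum-cong-≗ (λ i → ℕ.*-identityʳ (fixed i))) ⟩
    sum fixed % 2                   ∎
    where open ≡-Reasoning

module FixedPoints {n} (σ : Permutation′ n) where

  Fixed? : Decidable (λ i → σ ⟨$⟩ʳ i ≡ i)
  Fixed? i = σ ⟨$⟩ʳ i ≟ i

  fixedPoints : List (Fin n)
  fixedPoints = filter Fixed? (allFin n)

  fixedPoints-increasing : AllPairs _<_ fixedPoints
  fixedPoints-increasing = AllPairs.filter⁺ Fixed? (AllPairs.tabulate⁺-< id)

  length-fixedPoints : length fixedPoints ≡ sum (λ i → ⟦ Fixed? i ⟧)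
  length-fixedPoints = count-tabulate Fixed? id

  -- Three increasing fixed points would be an occurrence of 123.
  fixed-chain-≤2 : Avoids123 σ → (xs : List (Fin n)) →
    AllPairs _<_ xs → All (λ i → σ ⟨$⟩ʳ i ≡ i) xs → length xs ≤ 2
  fixed-chain-≤2 avoids []              _ _ = z≤n
  fixed-chain-≤2 avoids (_ ∷ [])        _ _ = s≤s z≤n
  fixed-chain-≤2 avoids (_ ∷ _ ∷ [])    _ _ = s≤s (s≤s z≤n)
  fixed-chain-≤2 avoids (x ∷ y ∷ z ∷ _) ((x<y ∷ _) ∷ (y<z ∷ _) ∷ _) (σx≡x ∷ σy≡y ∷ σz≡z ∷ _) =
    ⊥-elim (avoids (x , y , z , x<y , y<z ,
      subst₂ _<_ (sym σx≡x) (sym σy≡y) x<y , subst₂ _<_ (sym σy≡y) (sym σz≡z) y<z))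

  fixedCount-≤2 : Avoids123 σ → sum (λ i → ⟦ Fixed? i ⟧) ≤ 2
  fixedCount-≤2 avoids = subst (_≤ 2) length-fixedPoints
    (fixed-chain-≤2 avoids fixedPoints fixedPoints-increasing (all-filter Fixed? (allFin n)))

  hasFixedPoint⇔ : HasFixedPoint σ ⇔ 1 ≤ sum (λ i → ⟦ Fixed? i ⟧)
  hasFixedPoint⇔ = mk⇔
    (λ (i , σi≡i) → subst (1 ≤_) length-fixedPoints (nonempty (∈-filter⁺ Fixed? (∈-allFin i) σi≡i)))
    (λ 1≤count → first (all-filter Fixed? (allFin n)) (subst (1 ≤_) (sym length-fixedPoints) 1≤count))
    where
    nonempty : ∀ {i : Fin n} {xs} → i ∈ xs → 1 ≤ length xs
    nonempty (here _)  = s≤s z≤n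
    nonempty (there _) = s≤s z≤n
    first : ∀ {xs} → All (λ i → σ ⟨$⟩ʳ i ≡ i) xs → 1 ≤ length xs → HasFixedPoint σ
    first (σx≡x ∷ _) _ = _ , σx≡x

corollary3p23 : (n : ℕ) (ι : Permutation′ n) → IsInvolution ι → Avoids123 ι →
    ((coinv ι % 2 ≡ 1) ⇔ ((n % 2 ≡ 0) × HasFixedPoint ι))
corollary3p23 n ι ι-invol avoids =
  subst₂ (λ c m → (c ≡ 1) ⇔ ((m ≡ 0) × HasFixedPoint ι)) (sym coinv-parity) (sym length-parity)
    (⇔.trans (pairs-parity {A = pairs fixed} (fixedCount-≤2 avoids) (pairs-formula Fixed?))
             (⇔.refl ×-⇔ ⇔.sym hasFixedPoint⇔))
  where
  open Coinversions ι ι-invol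
  open Involution (ι ⟨$⟩ʳ_) ι-invol using (fixed)
  open FixedPoints ι
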